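{- Let $\Gamma$ be a finite $(G,2)$-geodesic-transitive digraph of valency $4$, where $G\leq\mathrm{Aut}(\Gamma)$. Then $|\Gamma^+(u)\cap\Gamma^+(v)|\neq 1$ for every arc $(u,v)$.
   Context: A digraph $\Gamma$ consists of a finite vertex set $V(\Gamma)$ with an antisymmetric irreflexive relation $\rightarrow$; an arc is an ordered pair $(u,v)$ with $u\rightarrow v$; $\Gamma^+(v)=\{w: v\rightarrow w\}$ and the valency is $|\Gamma^+(v)|$. The distance $d_\Gamma(u,v)$ is the length of a shortest directed path from $u$ to $v$. An $s$-arc is a sequence $(v_0,\dots,v_s)$ with $v_i\rightarrow v_{i+1}$ for all $i$; it is an $s$-geodesic if $d_\Gamma(v_0,v_s)=s$. $\Gamma$ is $(G,s)$-geodesic-transitive if $G$ is transitive on the set of $i$-geodesics for each $i\leq s$. -}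

module Defs where

open import Data.Nat using (ℕ; zero; suc; _<_; _≤_)
open import Data.Unit using (⊤)
open import Data.Fin using (Fin)
open import Data.Bool using (Bool; T; _∧_)
open import Data.List using (List; filter; length; allFin)
open import Data.Vec using (Vec; []; _∷_; head; last; map)
open import Data.Product using (Σ; ∃; _×_; _,_)
open import Data.Empty using (⊥)
open import Relation.Nullary using (¬_)
open import Relation.Nullary.Decidable using (does)
open import Data.Bool.Properties using (T?)
open import Relation.Binary.PropositionalEquality using (_≡_)
open import Function.Bundles using (_↔_; Inverse)
open import Function.Properties.Inverse using (↔-refl; ↔-sym; ↔-trans)

record Digraph (n : ℕ) : Set where
  field
    arc      : Fin n → Fin n → Bool
    irrefl   : ∀ u → ¬ T (arc u u)
    antisym  : ∀ u v → T (arc u v) → ¬ T (arc v u)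
open Digraph public

module _ {n : ℕ} (Γ : Digraph n) where

  outNbrs : Fin n → List (Fin n)
  outNbrs v = filter (λ w → T? (arc Γ v w)) (allFin n)

  commonOut : Fin n → Fin n → List (Fin n)
  commonOut u v = filter (λ w → T? (arc Γ u w ∧ arc Γ v w)) (allFin n)

  HasValency : ℕ → Set
  HasValency k = ∀ v → length (outNbrs v) ≡ k

  data Walk : Fin n → Fin n → ℕ → Set where
    here : ∀ {u} → Walk u u zero
    step : ∀ {u w v k} → T (arc Γ u w) → Walk w v k → Walk u v (suc k)

  IsArcSeq : ∀ {s} → Vec (Fin n) (suc s) → Set
  IsArcSeq (v ∷ []) = ⊤
  IsArcSeq (v ∷ w ∷ vs) = T (arc Γ v w) × IsArcSeq (w ∷ vs)

  -- d(v₀, v_s) = s : no directed walk of length < s from v₀ to v_s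
  -- (the s-arc itself is a walk of length s)
  IsGeodesic : ∀ s → Vec (Fin n) (suc s) → Set
  IsGeodesic s p = IsArcSeq p × (∀ k → k < s → ¬ Walk (head p) (last p) k)

  IsAut : Fin n ↔ Fin n → Set
  IsAut g = ∀ u v → arc Γ (Inverse.to g u) (Inverse.to g v) ≡ arc Γ u v

  record IsAutSubgroup (G : Fin n ↔ Fin n → Set) : Set where
    field
      auts    : ∀ g → G g → IsAut g
      has-id  : G ↔-refl
      has-inv : ∀ g → G g → G (↔-sym g)
      has-comp : ∀ g h → G g → G h → G (↔-trans g h)

  GeodesicTransitiveAt : (Fin n ↔ Fin n → Set) → ℕ → Set
  GeodesicTransitiveAt G i =
    ∀ (p q : Vec (Fin n) (suc i)) → IsGeodesic i p → IsGeodesic i q →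
    ∃ λ g → G g × map (Inverse.to g) p ≡ q

  IsGeodesicTransitive : (Fin n ↔ Fin n → Set) → ℕ → Set
  IsGeodesicTransitive G s = ∀ i → i ≤ s → GeodesicTransitiveAt G i

-- If w were the only common out-neighbour of an arc (u,v), arc-transitivity would move
-- (u,v) to (v,w), so v and w have a single common out-neighbour y, and (u,v,y) is a
-- 2-geodesic. An out-neighbour x of v other than w is not an out-neighbour of u, so
-- (u,v,x) is a 2-geodesic as well; an element of G sending (u,v,y) to (u,v,x) fixes u
-- and v, hence w, hence y, so x = y. Thus v has at most two out-neighbours.
module Submission where

open import Defs
open import Data.Nat using (ℕ; suc; _≤_; z≤n; s≤s)
open import Data.Nat.Properties using (n≤1+n)
open import Data.Fin using (Fin; _≟_)
open import Data.Bool using (T)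
open import Data.Bool.Properties using (T?; T-∧)
open import Data.List using (List; []; _∷_; [_]; length; allFin)
open import Data.List.Membership.Propositional using (_∈_)
open import Data.List.Membership.Propositional.Properties using (∈-filter⁺; ∈-filter⁻; ∈-allFin)
open import Data.List.Relation.Unary.Any using (here; there)
open import Data.List.Relation.Unary.All using (_∷_)
open import Data.List.Relation.Unary.AllPairs using (_∷_)
open import Data.List.Relation.Unary.Unique.Propositional using (Unique)
import Data.List.Relation.Unary.Unique.Propositional.Properties as Unique
open import Data.Vec using ([]; _∷_)
open import Data.Product using (∃; ∃-syntax; _×_; _,_; proj₁; proj₂)
open import Data.Sum using (_⊎_; inj₁; inj₂)
open import Function using (_∘_; Equivalence)
open import Function.Bundles using (_↔_; Inverse)
open import Relation.Nullary using (¬_; yes; no)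
open import Relation.Binary.Definitions using (DecidableEquality)
open import Relation.Binary.PropositionalEquality
  using (_≡_; _≢_; refl; sym; cong; subst; subst₂; ≢-sym; module ≡-Reasoning)

module _ {a} {A : Set a} (_≟ᴬ_ : DecidableEquality A) where

  ≢-avoid : ∀ {y z} → y ≢ z → ∀ c → y ≢ c ⊎ z ≢ c
  ≢-avoid {y} y≢z c with y ≟ᴬ c
  ... | yes refl = inj₂ (≢-sym y≢z)
  ... | no y≢c   = inj₁ y≢c

  ∃-avoiding₂ : ∀ {xs : List A} → Unique xs → 3 ≤ length xs →
                ∀ b c → ∃[ x ] x ∈ xs × x ≢ b × x ≢ c
  ∃-avoiding₂ {x ∷ y ∷ z ∷ _} ((x≢y ∷ x≢z ∷ _) ∷ (y≢z ∷ _) ∷ _) (s≤s (s≤s (s≤s _))) b c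
    with x ≟ᴬ b | x ≟ᴬ c
  ... | no x≢b | no x≢c = x , here refl , x≢b , x≢c
  ... | yes refl | _ with ≢-avoid y≢z c
  ...   | inj₁ y≢c = y , there (here refl) , ≢-sym x≢y , y≢c
  ...   | inj₂ z≢c = z , there (there (here refl)) , ≢-sym x≢z , z≢c
  ∃-avoiding₂ {x ∷ y ∷ z ∷ _} ((x≢y ∷ x≢z ∷ _) ∷ (y≢z ∷ _) ∷ _) (s≤s (s≤s (s≤s _))) b c
      | no _ | yes refl with ≢-avoid y≢z b
  ...   | inj₁ y≢b = y , there (here refl) , y≢b , ≢-sym x≢y
  ...   | inj₂ z≢b = z , there (there (here refl)) , z≢b , ≢-sym x≢z

length≡1⇒singleton : ∀ {a} {A : Set a} {xs : List A} → length xs ≡ 1 → ∃[ x ] xs ≡ [ x ]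
length≡1⇒singleton {xs = x ∷ []} _ = x , refl

module _ {n : ℕ} (Γ : Digraph n) where

  Arc : Fin n → Fin n → Set
  Arc u v = T (arc Γ u v)

  IsSoleCommonOut : Fin n → Fin n → Fin n → Set
  IsSoleCommonOut u v w = Arc u w × Arc v w × (∀ z → Arc u z → Arc v z → z ≡ w)

  ∈-outNbrs⁻ : ∀ {v w} → w ∈ outNbrs Γ v → Arc v w
  ∈-outNbrs⁻ {v} w∈ = let _ , v→w = ∈-filter⁻ (T? ∘ arc Γ v) {xs = allFin n} w∈ in v→w

  outNbrs-unique : ∀ v → Unique (outNbrs Γ v)
  outNbrs-unique v = Unique.filter⁺ (T? ∘ arc Γ v) (Unique.allFin⁺ n)

  ∈-commonOut⁺ : ∀ {u v w} → Arc u w → Arc v w → w ∈ commonOut Γ u v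
  ∈-commonOut⁺ {w = w} u→w v→w =
    ∈-filter⁺ (λ z → T? _) (∈-allFin w) (Equivalence.from T-∧ (u→w , v→w))

  ∈-commonOut⁻ : ∀ {u v w} → w ∈ commonOut Γ u v → Arc u w × Arc v w
  ∈-commonOut⁻ w∈ =
    let _ , both = ∈-filter⁻ (λ z → T? _) {xs = allFin n} w∈ in Equivalence.to T-∧ both

  length-commonOut≡1⇒sole : ∀ {u v} → length (commonOut Γ u v) ≡ 1 → ∃ (IsSoleCommonOut u v)
  length-commonOut≡1⇒sole {u} {v} len with length≡1⇒singleton len
  ... | w , eq = w , u→w , v→w , only
    where
    u→w×v→w = ∈-commonOut⁻ (subst (w ∈_) (sym eq) (here refl))
    u→w = proj₁ u→w×v→w
    v→w = proj₂ u→w×v→w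
    only : ∀ z → Arc u z → Arc v z → z ≡ w
    only z u→z v→z with subst (z ∈_) eq (∈-commonOut⁺ u→z v→z)
    ... | here z≡w = z≡w

  module _ (g : Fin n ↔ Fin n) (g-aut : IsAut Γ g) where
    open Inverse g using (to; from; strictlyInverseˡ)

    Arc-preserved : ∀ {u v} → Arc u v → Arc (to u) (to v)
    Arc-preserved {u} {v} = subst T (sym (g-aut u v))

    Arc-reflected : ∀ {u v} → Arc (to u) (to v) → Arc u v
    Arc-reflected {u} {v} = subst T (g-aut u v)

    Arc-reflectedʳ : ∀ {u z} → Arc (to u) z → Arc u (from z)
    Arc-reflectedʳ {z = z} = Arc-reflected ∘ subst (Arc _) (sym (strictlyInverseˡ z))

    IsSoleCommonOut-preserved : ∀ {u v w} → IsSoleCommonOut u v w → IsSoleCommonOut (to u) (to v) (to w)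
    IsSoleCommonOut-preserved {w = w} (u→w , v→w , only) =
      Arc-preserved u→w , Arc-preserved v→w , λ z gu→z gv→z → begin
        z            ≡⟨ strictlyInverseˡ z ⟨
        to (from z)  ≡⟨ cong to (only (from z) (Arc-reflectedʳ gu→z) (Arc-reflectedʳ gv→z)) ⟩
        to w         ∎
      where open ≡-Reasoning

  no-walk-of-length-0 : ∀ {u v} → u ≢ v → ¬ Walk Γ u v 0
  no-walk-of-length-0 u≢v here = u≢v refl

  no-walk-of-length-1 : ∀ {u v} → ¬ Arc u v → ¬ Walk Γ u v 1
  no-walk-of-length-1 ¬u→v (step u→v here) = ¬u→v u→v

  arc⇒1-geodesic : ∀ {u v} → Arc u v → IsGeodesic Γ 1 (u ∷ v ∷ [])
  arc⇒1-geodesic u→v = (u→v , _) , λ where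
    0 _ → no-walk-of-length-0 λ { refl → irrefl Γ _ u→v }
    (suc _) (s≤s ())

  2-arc⇒2-geodesic : ∀ {u v x} → Arc u v → Arc v x → ¬ Arc u x → IsGeodesic Γ 2 (u ∷ v ∷ x ∷ [])
  2-arc⇒2-geodesic {u} {v} u→v v→x ¬u→x = (u→v , v→x , _) , λ where
    0 _ → no-walk-of-length-0 λ { refl → antisym Γ u v u→v v→x }
    1 _ → no-walk-of-length-1 ¬u→x
    (suc (suc _)) (s≤s (s≤s ()))

module _ {n : ℕ} {Γ : Digraph n} {G : Fin n ↔ Fin n → Set} where

  arc-transitive : GeodesicTransitiveAt Γ G 1 → ∀ {u v u′ v′} → Arc Γ u v → Arc Γ u′ v′ →
                   ∃[ g ] G g × Inverse.to g u ≡ u′ × Inverse.to g v ≡ v′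
  arc-transitive trans₁ u→v u′→v′
    with trans₁ _ _ (arc⇒1-geodesic Γ u→v) (arc⇒1-geodesic Γ u′→v′)
  ... | g , g∈G , refl = g , g∈G , refl , refl

  2-arc-transitive : GeodesicTransitiveAt Γ G 2 → ∀ {u v x u′ v′ x′} →
                     IsGeodesic Γ 2 (u ∷ v ∷ x ∷ []) → IsGeodesic Γ 2 (u′ ∷ v′ ∷ x′ ∷ []) →
                     ∃[ g ] G g × Inverse.to g u ≡ u′ × Inverse.to g v ≡ v′ × Inverse.to g x ≡ x′
  2-arc-transitive trans₂ p q with trans₂ _ _ p q
  ... | g , g∈G , refl = g , g∈G , refl , refl , refl

  module _ (G⊆Aut : ∀ g → G g → IsAut Γ g) where

    IsSoleCommonOut-shift : GeodesicTransitiveAt Γ G 1 → ∀ {u v w} → Arc Γ u v →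
                            IsSoleCommonOut Γ u v w → ∃ (IsSoleCommonOut Γ v w)
    IsSoleCommonOut-shift trans₁ {w = w} u→v sole@(_ , v→w , _) with arc-transitive trans₁ u→v v→w
    ... | g , g∈G , gu≡v , gv≡w =
      Inverse.to g w , subst₂ (λ a b → IsSoleCommonOut Γ a b (Inverse.to g w)) gu≡v gv≡w
                 (IsSoleCommonOut-preserved Γ g (G⊆Aut g g∈G) sole)

    2-geodesic-end-forced : GeodesicTransitiveAt Γ G 2 → ∀ {u v w y x} → Arc Γ u v →
                           IsSoleCommonOut Γ u v w → IsSoleCommonOut Γ v w y →
                           Arc Γ v x → ¬ Arc Γ u x → x ≡ y
    2-geodesic-end-forced trans₂ {u = u} {w = w} {y = y} {x = x} u→v
                          (u→w , v→w , only-uv) (v→y , w→y , only-vw) v→x ¬u→x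
      with 2-arc-transitive trans₂ (2-arc⇒2-geodesic Γ u→v v→y ¬u→y)
                                   (2-arc⇒2-geodesic Γ u→v v→x ¬u→x)
      where
      ¬u→y : ¬ Arc Γ u y
      ¬u→y u→y = irrefl Γ w (subst (Arc Γ w) (only-uv y u→y v→y) w→y)
    ... | h , h∈G , hu≡u , hv≡v , hy≡x = begin
      x       ≡⟨ hy≡x ⟨
      h⟨ y ⟩  ≡⟨ only-vw h⟨ y ⟩ (moved hv≡v refl v→y) (moved hw≡w refl w→y) ⟩
      y       ∎
      where
      open ≡-Reasoning
      h⟨_⟩ = Inverse.to h
      moved : ∀ {a b a′ b′} → h⟨ a ⟩ ≡ a′ → h⟨ b ⟩ ≡ b′ → Arc Γ a b → Arc Γ a′ b′
      moved ha hb = subst₂ (Arc Γ) ha hb ∘ Arc-preserved Γ h (G⊆Aut h h∈G)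
      hw≡w : h⟨ w ⟩ ≡ w
      hw≡w = only-uv h⟨ w ⟩ (moved hu≡u refl u→w) (moved hv≡v refl v→w)

    no-sole-common-out : GeodesicTransitiveAt Γ G 1 → GeodesicTransitiveAt Γ G 2 →
                         ∀ {u v w} → 3 ≤ length (outNbrs Γ v) → Arc Γ u v → ¬ IsSoleCommonOut Γ u v w
    no-sole-common-out trans₁ trans₂ {u} {v} {w} 3≤deg u→v sole@(_ , _ , only-uv)
      with IsSoleCommonOut-shift trans₁ u→v sole
    ... | y , sole′ with ∃-avoiding₂ _≟_ (outNbrs-unique Γ v) 3≤deg w y
    ... | x , x∈Γ⁺v , x≢w , x≢y with T? (arc Γ u x)
    ...   | yes u→x = x≢w (only-uv x u→x (∈-outNbrs⁻ Γ x∈Γ⁺v))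
    ...   | no ¬u→x = x≢y (2-geodesic-end-forced trans₂ u→v sole sole′ (∈-outNbrs⁻ Γ x∈Γ⁺v) ¬u→x)

lemma4p5 : (n : ℕ) (Γ : Digraph n) (G : Fin n ↔ Fin n → Set) →
    IsAutSubgroup Γ G → IsGeodesicTransitive Γ G 2 → HasValency Γ 4 →
    ∀ u v → T (arc Γ u v) → length (commonOut Γ u v) ≢ 1
lemma4p5 n Γ G G≤Aut geo-trans valency-4 u v u→v len≡1 =
  let w , sole = length-commonOut≡1⇒sole Γ len≡1 in
  no-sole-common-out (IsAutSubgroup.auts G≤Aut) (geo-trans 1 (s≤s z≤n)) (geo-trans 2 (s≤s (s≤s z≤n)))
    (subst (3 ≤_) (sym (valency-4 v)) (n≤1+n 3)) u→v sole
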